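{- Let $a\in S_n$. (i) If some cycle of $a$ has the form $(i_0\,\cdots\,i_{d-1}\,i_d\,\cdots\,i_{kd-1})$ (with $i_{j+1}=a(i_j)$) where $d\ge1$, $k>1$ and $f(i_{cd+t})=f(i_t)$ for $t=0,1,\dots,d-1$ and $c=0,1,\dots,k-1$, then $a$ is not $f$-simple. (ii) If $a$ has two distinct cycles $(i_0\,\cdots\,i_{d-1})$ and $(j_0\,\cdots\,j_{d-1})$ (with $i_{t+1}=a(i_t)$, $j_{t+1}=a(j_t)$), where $d\ge1$ and $f(i_k)=f(j_k)$ for every $0\le k\le d-1$, then $a$ is not $f$-simple.
   Context: $f$ is an arbitrary map from $\{1,\dots,n\}$ to some set, $S_n$ is the symmetric group on $\{1,\dots,n\}$, and $G_f=\{\sigma\in S_n: f(\sigma(i))=f(i)\text{ for all }i\}$. A permutation $a\in S_n$ is called $f$-simple if its centralizer in $G_f$ is trivial, i.e. the only $\sigma\in G_f$ with $\sigma a=a\sigma$ is the identity. Cycles of a permutation include cycles of length $1$ (fixed points). -}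

module Defs where

open import Level using (Level)
open import Data.Nat using (ℕ; zero; suc; _+_; _*_; _<_)
open import Data.Fin using (Fin)
open import Data.Fin.Permutation using (Permutation′; _⟨$⟩ʳ_)
open import Data.Product using (_×_)
open import Relation.Binary.PropositionalEquality using (_≡_; _≢_)

-- S_n is modelled as Permutation′ n (bijections Fin n ↔ Fin n);
-- {1,…,n} is modelled as Fin n (i.e. {0,…,n-1}).

iter : ∀ {n} → Permutation′ n → ℕ → Fin n → Fin n
iter a zero    i = i
iter a (suc m) i = a ⟨$⟩ʳ (iter a m i)

InGf : ∀ {ℓ} {A : Set ℓ} {n} → (Fin n → A) → Permutation′ n → Set ℓ
InGf f σ = ∀ i → f (σ ⟨$⟩ʳ i) ≡ f i

Commutes : ∀ {n} → Permutation′ n → Permutation′ n → Set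
Commutes σ a = ∀ i → σ ⟨$⟩ʳ (a ⟨$⟩ʳ i) ≡ a ⟨$⟩ʳ (σ ⟨$⟩ʳ i)

IsId : ∀ {n} → Permutation′ n → Set
IsId σ = ∀ i → σ ⟨$⟩ʳ i ≡ i

fSimple : ∀ {ℓ} {A : Set ℓ} {n} → (Fin n → A) → Permutation′ n → Set ℓ
fSimple f a = ∀ σ → InGf f σ → Commutes σ a → IsId σ

CycleLength : ∀ {n} → Permutation′ n → Fin n → ℕ → Set
CycleLength a i m = (iter a m i ≡ i) × (∀ j → 0 < j → j < m → iter a j i ≢ i)

{-# OPTIONS --safe #-}

-- In both cases we exhibit a nontrivial element of the centralizer of a in G_f: a bijection g
-- of an a-invariant set of points that commutes with a and preserves f there, extended by the
-- identity elsewhere. In (i) g is a^d on the given cycle, which preserves f because the labelling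
-- of the cycle is d-periodic. In (ii) g exchanges a^t i₀ and a^t j₀; this is well defined
-- because both cycles have length d, and preserves f because the labellings agree.

module Submission where

open import Defs
open import Level using (Level; 0ℓ)
open import Data.Nat using (ℕ; zero; suc; pred; _+_; _*_; _∸_; _<_; _≤_; z≤n; s≤s; NonZero)
open import Data.Nat.Properties
  using (+-suc; +-comm; suc-pred; <-cmp; m<m+n; m+[n∸m]≡n; m<n⇒0<n∸m; m∸n≤m; ≤-<-trans; <⇒≤; anyUpTo?)
open import Data.Nat.DivMod using (_%_; _/_; m≡m%n+[m/n]*n; m%n<n; m<n*o⇒m/o<n; m∣n⇒o%n%m≡o%m; %-remove-+ˡ)
open import Data.Nat.Divisibility using (n∣m*n; ∣-refl)
open import Data.Fin using (Fin) renaming (_≟_ to _≟ᶠ_)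
open import Data.Fin.Permutation using (Permutation′; _⟨$⟩ʳ_; _⟨$⟩ˡ_; inverseˡ; permutation)
open import Data.Product using (Σ; _×_; _,_; ∃-syntax)
open import Data.Sum as Sum using (inj₁; inj₂; [_,_]′)
open import Relation.Nullary using (¬_; yes; no; contradiction)
open import Relation.Nullary.Decidable using (map′; toSum)
open import Function using (_∘_)
open import Relation.Unary using (Pred; Decidable; _∪_)
open import Relation.Unary.Properties using (_∪?_)
open import Relation.Binary.Definitions using (tri<; tri≈; tri>)
open import Relation.Binary.PropositionalEquality
open ≡-Reasoning

module _ {n : ℕ} (a : Permutation′ n) where

  iter-+ : ∀ m k x → iter a (m + k) x ≡ iter a m (iter a k x)
  iter-+ zero    k x = refl
  iter-+ (suc m) k x = cong (a ⟨$⟩ʳ_) (iter-+ m k x)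

  iter-comm : ∀ m x → iter a m (a ⟨$⟩ʳ x) ≡ a ⟨$⟩ʳ iter a m x
  iter-comm zero    x = refl
  iter-comm (suc m) x = cong (a ⟨$⟩ʳ_) (iter-comm m x)

  iter-injective : ∀ m {x y} → iter a m x ≡ iter a m y → x ≡ y
  iter-injective zero    e = e
  iter-injective (suc m) {x} {y} e = iter-injective m (begin
    iter a m x                  ≡⟨ inverseˡ a ⟨
    a ⟨$⟩ˡ (a ⟨$⟩ʳ iter a m x)  ≡⟨ cong (a ⟨$⟩ˡ_) e ⟩
    a ⟨$⟩ˡ (a ⟨$⟩ʳ iter a m y)  ≡⟨ inverseˡ a ⟩
    iter a m y                  ∎)

  InOrbit : Fin n → Pred (Fin n) 0ℓ
  InOrbit x y = ∃[ t ] iter a t x ≡ y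

  InOrbit-iter : ∀ {x y} m → InOrbit x y → InOrbit x (iter a m y)
  InOrbit-iter {x} m (t , refl) = m + t , iter-+ m t x

  module _ {L : ℕ} {x : Fin n} (per : iter a L x ≡ x) where

    iter-*-periodic : ∀ q → iter a (q * L) x ≡ x
    iter-*-periodic zero    = refl
    iter-*-periodic (suc q) = begin
      iter a (L + q * L) x         ≡⟨ iter-+ L (q * L) x ⟩
      iter a L (iter a (q * L) x)  ≡⟨ cong (iter a L) (iter-*-periodic q) ⟩
      iter a L x                   ≡⟨ per ⟩
      x                            ∎

    iter-% : .{{_ : NonZero L}} → ∀ s → iter a s x ≡ iter a (s % L) x
    iter-% s = begin
      iter a s x                                  ≡⟨ cong (λ m → iter a m x) (m≡m%n+[m/n]*n s L) ⟩
      iter a (s % L + (s / L) * L) x              ≡⟨ iter-+ (s % L) ((s / L) * L) x ⟩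
      iter a (s % L) (iter a ((s / L) * L) x)     ≡⟨ cong (iter a (s % L)) (iter-*-periodic (s / L)) ⟩
      iter a (s % L) x                            ∎

    iter-inverse-on-orbit : ∀ {y} m m′ → m + m′ ≡ L → InOrbit x y → iter a m (iter a m′ y) ≡ y
    iter-inverse-on-orbit m m′ m+m′≡L (t , refl) = begin
      iter a m (iter a m′ (iter a t x))  ≡⟨ iter-+ m m′ _ ⟨
      iter a (m + m′) (iter a t x)       ≡⟨ cong (λ k → iter a k (iter a t x)) m+m′≡L ⟩
      iter a L (iter a t x)              ≡⟨ iter-+ L t x ⟨
      iter a (L + t) x                   ≡⟨ cong (λ k → iter a k x) (+-comm L t) ⟩
      iter a (t + L) x                   ≡⟨ iter-+ t L x ⟩
      iter a t (iter a L x)              ≡⟨ cong (iter a t) per ⟩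
      iter a t x                         ∎

    inOrbit? : .{{_ : NonZero L}} → Decidable (InOrbit x)
    inOrbit? y = map′ (λ (t , _ , e) → t , e)
                      (λ (t , e) → t % L , m%n<n t L , trans (sym (iter-% t)) e)
                      (anyUpTo? (λ t → iter a t x ≟ᶠ y) L)

    InOrbit-a⁻ : .{{_ : NonZero L}} → ∀ {y} → InOrbit x (a ⟨$⟩ʳ y) → InOrbit x y
    InOrbit-a⁻ {y} (s , e) = s + pred L , iter-injective 1 (begin
      iter a (suc (s + pred L)) x   ≡⟨ cong (λ m → iter a m x) (sym (+-suc s (pred L))) ⟩
      iter a (s + suc (pred L)) x   ≡⟨ cong (λ m → iter a (s + m) x) (suc-pred L) ⟩
      iter a (s + L) x              ≡⟨ iter-+ s L x ⟩
      iter a s (iter a L x)         ≡⟨ cong (iter a s) per ⟩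
      iter a s x                    ≡⟨ e ⟩
      a ⟨$⟩ʳ y                      ∎)

    InOrbit-iter⁻ : .{{_ : NonZero L}} → ∀ {y} m → InOrbit x (iter a m y) → InOrbit x y
    InOrbit-iter⁻ zero    o = o
    InOrbit-iter⁻ (suc m) o = InOrbit-iter⁻ m (InOrbit-a⁻ o)

  module _ {L : ℕ} {x : Fin n} (cycle : CycleLength a x L) where

    open Σ cycle renaming (proj₁ to per; proj₂ to minimal)

    cycle-index-< : ∀ {s t} → s < t → t < L → iter a s x ≢ iter a t x
    cycle-index-< {s} {t} s<t t<L e =
      minimal (t ∸ s) (m<n⇒0<n∸m s<t) (≤-<-trans (m∸n≤m t s) t<L) (sym (iter-injective s (begin
        iter a s x                   ≡⟨ e ⟩
        iter a t x                   ≡⟨ cong (λ m → iter a m x) (m+[n∸m]≡n (<⇒≤ s<t)) ⟨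
        iter a (s + (t ∸ s)) x       ≡⟨ iter-+ s (t ∸ s) x ⟩
        iter a s (iter a (t ∸ s) x)  ∎)))

    cycle-index-unique : ∀ {s t} → s < L → t < L → iter a s x ≡ iter a t x → s ≡ t
    cycle-index-unique {s} {t} s<L t<L e with <-cmp s t
    ... | tri< s<t _ _ = contradiction e (cycle-index-< s<t t<L)
    ... | tri≈ _ s≡t _ = s≡t
    ... | tri> _ _ t<s = contradiction (sym e) (cycle-index-< t<s s<L)

    iter-≡-transfer : .{{_ : NonZero L}} → ∀ {y} → iter a L y ≡ y →
                      ∀ s t → iter a s x ≡ iter a t x → iter a s y ≡ iter a t y
    iter-≡-transfer {y} perʸ s t e = begin
      iter a s y        ≡⟨ iter-% perʸ s ⟩
      iter a (s % L) y  ≡⟨ cong (λ m → iter a m y) s%L≡t%L ⟩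
      iter a (t % L) y  ≡⟨ iter-% perʸ t ⟨
      iter a t y        ∎
      where
      s%L≡t%L : s % L ≡ t % L
      s%L≡t%L = cycle-index-unique (m%n<n s L) (m%n<n t L)
        (trans (sym (iter-% per s)) (trans e (iter-% per t)))


module _ {n : ℕ} (a : Permutation′ n) {p : Level} {P : Pred (Fin n) p} (P? : Decidable P)
         (P-a : ∀ {x} → P x → P (a ⟨$⟩ʳ x)) (P-a⁻ : ∀ {x} → P (a ⟨$⟩ʳ x) → P x) where

  extend : (Fin n → Fin n) → Fin n → Fin n
  extend g x with P? x
  ... | yes _ = g x
  ... | no  _ = x

  extend-∈ : ∀ g {x} → P x → extend g x ≡ g x
  extend-∈ g {x} Px with P? x
  ... | yes _   = refl
  ... | no  ¬Px = contradiction Px ¬Px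

  extend-∉ : ∀ g {x} → ¬ P x → extend g x ≡ x
  extend-∉ g {x} ¬Px with P? x
  ... | yes Px = contradiction Px ¬Px
  ... | no  _  = refl

  extend-inverse : ∀ g h → (∀ {x} → P x → P (g x)) → (∀ {x} → P x → h (g x) ≡ x) →
                   ∀ x → extend h (extend g x) ≡ x
  extend-inverse g h g-P h∘g x = [ inside , outside ]′ (toSum (P? x))
    where
    inside : P x → extend h (extend g x) ≡ x
    inside Px = begin
      extend h (extend g x) ≡⟨ cong (extend h) (extend-∈ g Px) ⟩
      extend h (g x)        ≡⟨ extend-∈ h (g-P Px) ⟩
      h (g x)               ≡⟨ h∘g Px ⟩
      x                     ∎
    outside : ¬ P x → extend h (extend g x) ≡ x
    outside ¬Px = trans (cong (extend h) (extend-∉ g ¬Px)) (extend-∉ h ¬Px)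

  module _ (g h : Fin n → Fin n)
           (g-P : ∀ {x} → P x → P (g x)) (h-P : ∀ {x} → P x → P (h x))
           (h∘g : ∀ {x} → P x → h (g x) ≡ x) (g∘h : ∀ {x} → P x → g (h x) ≡ x) where

    extension : Permutation′ n
    extension = permutation (extend g) (extend h)
                  (extend-inverse h g h-P g∘h) (extend-inverse g h g-P h∘g)

    extension-commutes : (∀ {x} → P x → g (a ⟨$⟩ʳ x) ≡ a ⟨$⟩ʳ g x) → Commutes extension a
    extension-commutes g-a x = [ inside , outside ]′ (toSum (P? x))
      where
      inside : P x → extend g (a ⟨$⟩ʳ x) ≡ a ⟨$⟩ʳ extend g x
      inside Px = begin
        extend g (a ⟨$⟩ʳ x)  ≡⟨ extend-∈ g (P-a Px) ⟩
        g (a ⟨$⟩ʳ x)         ≡⟨ g-a Px ⟩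
        a ⟨$⟩ʳ g x           ≡⟨ cong (a ⟨$⟩ʳ_) (extend-∈ g Px) ⟨
        a ⟨$⟩ʳ extend g x    ∎
      outside : ¬ P x → extend g (a ⟨$⟩ʳ x) ≡ a ⟨$⟩ʳ extend g x
      outside ¬Px = trans (extend-∉ g (¬Px ∘ P-a⁻)) (cong (a ⟨$⟩ʳ_) (sym (extend-∉ g ¬Px)))

    extension-InGf : ∀ {ℓ} {A : Set ℓ} (f : Fin n → A) → (∀ {x} → P x → f (g x) ≡ f x) →
                     InGf f extension
    extension-InGf f f∘g x = [ inside , outside ]′ (toSum (P? x))
      where
      inside : P x → f (extend g x) ≡ f x
      inside Px = trans (cong f (extend-∈ g Px)) (f∘g Px)
      outside : ¬ P x → f (extend g x) ≡ f x
      outside ¬Px = cong f (extend-∉ g ¬Px)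

    block-symmetry⇒¬fSimple : ∀ {ℓ} {A : Set ℓ} (f : Fin n → A) →
      (∀ {x} → P x → g (a ⟨$⟩ʳ x) ≡ a ⟨$⟩ʳ g x) → (∀ {x} → P x → f (g x) ≡ f x) →
      ∀ {x} → P x → g x ≢ x → ¬ fSimple f a
    block-symmetry⇒¬fSimple f g-a f∘g {x} Px gx≢x simple =
      gx≢x (trans (sym (extend-∈ g Px)) (simple extension (extension-InGf f f∘g) (extension-commutes g-a) x))

periodic-cycle⇒¬fSimple : ∀ {ℓ} {A : Set ℓ} {n : ℕ} (f : Fin n → A) (a : Permutation′ n) →
    (i₀ : Fin n) (d k : ℕ) → 1 ≤ d → 1 < k →
    CycleLength a i₀ (k * d) →
    (∀ c t → c < k → t < d → f (iter a (c * d + t) i₀) ≡ f (iter a t i₀)) →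
    ¬ fSimple f a
periodic-cycle⇒¬fSimple f a i₀ d k (s≤s z≤n) (s≤s (s≤s z≤n)) (per , minimal) hf =
  block-symmetry⇒¬fSimple a (inOrbit? a {k * d} per) (InOrbit-iter a {i₀} 1) (InOrbit-a⁻ a {k * d} per)
    (iter a d) (iter a (pred k * d)) (InOrbit-iter a {i₀} d) (InOrbit-iter a {i₀} (pred k * d))
    (iter-inverse-on-orbit a per (pred k * d) d (+-comm (pred k * d) d))
    (iter-inverse-on-orbit a per d (pred k * d) refl)
    f (λ {x} _ → iter-comm a d x) f-invariant-on-orbit (0 , refl) (minimal d (s≤s z≤n) d<k*d)
  where
  d<k*d : d < k * d
  d<k*d = m<m+n d (s≤s z≤n)

  f-residue : ∀ s → f (iter a s i₀) ≡ f (iter a (s % d) i₀)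
  f-residue s = begin
    f (iter a s i₀)                     ≡⟨ cong f (iter-% a per s) ⟩
    f (iter a r i₀)                     ≡⟨ cong (λ m → f (iter a m i₀)) r≡[r/d]*d+r%d ⟩
    f (iter a ((r / d) * d + r % d) i₀) ≡⟨ hf (r / d) (r % d) (m<n*o⇒m/o<n (m%n<n s (k * d))) (m%n<n r d) ⟩
    f (iter a (r % d) i₀)               ≡⟨ cong (λ m → f (iter a m i₀)) (m∣n⇒o%n%m≡o%m d (k * d) s (n∣m*n k)) ⟩
    f (iter a (s % d) i₀)               ∎
    where
    r : ℕ
    r = s % (k * d)
    r≡[r/d]*d+r%d : r ≡ (r / d) * d + r % d
    r≡[r/d]*d+r%d = trans (m≡m%n+[m/n]*n r d) (+-comm (r % d) ((r / d) * d))

  f-invariant-on-orbit : ∀ {x} → InOrbit a i₀ x → f (iter a d x) ≡ f x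
  f-invariant-on-orbit (t , refl) = begin
    f (iter a d (iter a t i₀))  ≡⟨ cong f (iter-+ a d t i₀) ⟨
    f (iter a (d + t) i₀)       ≡⟨ f-residue (d + t) ⟩
    f (iter a ((d + t) % d) i₀) ≡⟨ cong (λ m → f (iter a m i₀)) (%-remove-+ˡ t ∣-refl) ⟩
    f (iter a (t % d) i₀)       ≡⟨ f-residue t ⟨
    f (iter a t i₀)             ∎

twin-cycles⇒¬fSimple : ∀ {ℓ} {A : Set ℓ} {n : ℕ} (f : Fin n → A) (a : Permutation′ n) →
    (i₀ j₀ : Fin n) (d : ℕ) → 1 ≤ d →
    CycleLength a i₀ d → CycleLength a j₀ d →
    (∀ t → iter a t i₀ ≢ j₀) →
    (∀ t → t < d → f (iter a t i₀) ≡ f (iter a t j₀)) →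
    ¬ fSimple f a
twin-cycles⇒¬fSimple {n = n} f a i₀ j₀ d (s≤s z≤n) cycleᵢ@(perᵢ , _) cycleⱼ@(perⱼ , _) i₀↛j₀ hf =
  block-symmetry⇒¬fSimple a (inOrbit? a {d} perᵢ ∪? inOrbit? a {d} perⱼ)
    (Sum.map (InOrbit-iter a {i₀} 1) (InOrbit-iter a {j₀} 1))
    (Sum.map (InOrbit-a⁻ a {d} perᵢ) (InOrbit-a⁻ a {d} perⱼ))
    swap swap swap-∪ swap-∪ swap-involutive swap-involutive
    f swap-commutes f-invariant (inj₁ (0 , refl)) (λ e → i₀↛j₀ 0 (trans (sym e) (swap-i 0)))
  where
  j₀-orbit-disjoint : ∀ t → ¬ InOrbit a i₀ (iter a t j₀)
  j₀-orbit-disjoint t o = let (s , e) = InOrbit-iter⁻ a {d} perᵢ t o in i₀↛j₀ s e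

  swap : Fin n → Fin n
  swap x with inOrbit? a {d} perᵢ x | inOrbit? a {d} perⱼ x
  ... | yes (t , _) | _           = iter a t j₀
  ... | no  _       | yes (t , _) = iter a t i₀
  ... | no  _       | no  _       = x

  swap-i : ∀ t → swap (iter a t i₀) ≡ iter a t j₀
  swap-i t with inOrbit? a {d} perᵢ (iter a t i₀) | inOrbit? a {d} perⱼ (iter a t i₀)
  ... | yes (s , e) | _ = iter-≡-transfer a {d} cycleᵢ perⱼ s t e
  ... | no  ¬o      | _ = contradiction (t , refl) ¬o

  swap-j : ∀ t → swap (iter a t j₀) ≡ iter a t i₀
  swap-j t with inOrbit? a {d} perᵢ (iter a t j₀) | inOrbit? a {d} perⱼ (iter a t j₀)
  ... | yes o  | _           = contradiction o (j₀-orbit-disjoint t)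
  ... | no  _  | yes (s , e) = iter-≡-transfer a {d} cycleⱼ perᵢ s t e
  ... | no  _  | no  ¬o      = contradiction (t , refl) ¬o

  Twins : Pred (Fin n) 0ℓ
  Twins = InOrbit a i₀ ∪ InOrbit a j₀

  swap-∪ : ∀ {x} → Twins x → Twins (swap x)
  swap-∪ (inj₁ (t , refl)) = inj₂ (t , sym (swap-i t))
  swap-∪ (inj₂ (t , refl)) = inj₁ (t , sym (swap-j t))

  swap-involutive : ∀ {x} → Twins x → swap (swap x) ≡ x
  swap-involutive (inj₁ (t , refl)) = trans (cong swap (swap-i t)) (swap-j t)
  swap-involutive (inj₂ (t , refl)) = trans (cong swap (swap-j t)) (swap-i t)

  swap-commutes : ∀ {x} → Twins x → swap (a ⟨$⟩ʳ x) ≡ a ⟨$⟩ʳ swap x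
  swap-commutes (inj₁ (t , refl)) = trans (swap-i (suc t)) (cong (a ⟨$⟩ʳ_) (sym (swap-i t)))
  swap-commutes (inj₂ (t , refl)) = trans (swap-j (suc t)) (cong (a ⟨$⟩ʳ_) (sym (swap-j t)))

  f-twin : ∀ t → f (iter a t i₀) ≡ f (iter a t j₀)
  f-twin t = begin
    f (iter a t i₀)        ≡⟨ cong f (iter-% a perᵢ t) ⟩
    f (iter a (t % d) i₀)  ≡⟨ hf (t % d) (m%n<n t d) ⟩
    f (iter a (t % d) j₀)  ≡⟨ cong f (iter-% a perⱼ t) ⟨
    f (iter a t j₀)        ∎

  f-invariant : ∀ {x} → Twins x → f (swap x) ≡ f x
  f-invariant (inj₁ (t , refl)) = trans (cong f (swap-i t)) (sym (f-twin t))
  f-invariant (inj₂ (t , refl)) = trans (cong f (swap-j t)) (f-twin t)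

lemma4p4 : ∀ {ℓ} {A : Set ℓ} {n : ℕ} (f : Fin n → A) (a : Permutation′ n) →
    ((i₀ : Fin n) (d k : ℕ) → 1 ≤ d → 1 < k →
      CycleLength a i₀ (k * d) →
      (∀ c t → c < k → t < d → f (iter a (c * d + t) i₀) ≡ f (iter a t i₀)) →
      ¬ fSimple f a)
    ×
    ((i₀ j₀ : Fin n) (d : ℕ) → 1 ≤ d →
      CycleLength a i₀ d → CycleLength a j₀ d →
      (∀ t → iter a t i₀ ≢ j₀) →
      (∀ t → t < d → f (iter a t i₀) ≡ f (iter a t j₀)) →
      ¬ fSimple f a)
lemma4p4 f a = periodic-cycle⇒¬fSimple f a , twin-cycles⇒¬fSimple f a
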